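{- Let $G_1$ and $G_2$ be two vertex-disjoint graphs. Then $\chi_c(G_1\cup G_2)=\max\{\chi_c(G_1),\chi_c(G_2)\}$ and $\chi_c(G_1\vee G_2)=2$. If $G$ is a quasi-spider, then $\chi_c(G)=2$.
   Context: $G_1\cup G_2$ is the disjoint union and $G_1\vee G_2$ the join (disjoint union plus all edges between $V(G_1)$ and $V(G_2)$). A clique coloring of a graph is a partition of its vertices into color classes (not necessarily stable) such that every maximal clique receives at least two colors; $\chi_c(G)$ is the minimum number of colors in a clique coloring. A spider is a graph whose vertex set has a partition $(R,C,S)$ with $C=\{c_1,\dots,c_k\}$ a clique and $S=\{s_1,\dots,s_k\}$ a stable set, $k\ge 2$, such that either $s_i$ is adjacent to $c_j$ iff $i=j$ (thin) or iff $i\ne j$ (thick), and every vertex of $R$ is adjacent to every vertex of $C$ and to no vertex of $S$. A quasi-spider is obtained from a spider by replacing at most one vertex of $C\cup S$ by a $K_2$ or a $\overline{K_2}$ (the two new vertices having the same neighbours outside them as the replaced vertex). -}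

module Defs where

open import Data.Nat using (ℕ; _≤_; _⊔_; _+_)
open import Data.Bool using (Bool; true; false)
open import Data.Fin using (Fin; splitAt)
open import Data.Fin.Subset using (Subset; _∈_; _⊆_)
open import Data.Sum using (_⊎_; inj₁; inj₂)
open import Data.Product using (Σ; ∃; ∃-syntax; _×_; _,_)
open import Data.Maybe using (Maybe; just)
open import Data.Unit using (⊤)
open import Relation.Nullary using (¬_)
open import Relation.Binary.PropositionalEquality using (_≡_; _≢_; refl)

record Graph : Set where
  field
    n     : ℕ
    adj   : Fin n → Fin n → Bool
    sym   : ∀ u v → adj u v ≡ adj v u
    irrefl : ∀ u → adj u u ≡ false
open Graph public

Edge : (G : Graph) → Fin (n G) → Fin (n G) → Set
Edge G u v = adj G u v ≡ true

IsClique : (G : Graph) → Subset (n G) → Set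
IsClique G Q = ∀ u v → u ∈ Q → v ∈ Q → u ≢ v → Edge G u v

IsMaximalClique : (G : Graph) → Subset (n G) → Set
IsMaximalClique G Q = IsClique G Q × (∀ Q′ → IsClique G Q′ → Q ⊆ Q′ → Q′ ⊆ Q)

IsCliqueColoring : (G : Graph) (k : ℕ) → (Fin (n G) → Fin k) → Set
IsCliqueColoring G k col =
  ∀ Q → IsMaximalClique G Q → ∃[ u ] ∃[ v ] (u ∈ Q × v ∈ Q × col u ≢ col v)

HasCliqueColoring : Graph → ℕ → Set
HasCliqueColoring G k = Σ (Fin (n G) → Fin k) (IsCliqueColoring G k)

ChiC≡ : Graph → ℕ → Set
ChiC≡ G k = HasCliqueColoring G k × (∀ j → HasCliqueColoring G j → k ≤ j)

-- Disjoint union and join, on vertex set Fin (n₁ + n₂)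
-- (first n₁ vertices are those of G₁, the remaining ones those of G₂).

private
  unionAdj : (b : Bool) (G₁ G₂ : Graph) → Fin (n G₁ + n G₂) → Fin (n G₁ + n G₂) → Bool
  unionAdj b G₁ G₂ u v with splitAt (n G₁) u | splitAt (n G₁) v
  ... | inj₁ i | inj₁ j = adj G₁ i j
  ... | inj₂ i | inj₂ j = adj G₂ i j
  ... | inj₁ _ | inj₂ _ = b
  ... | inj₂ _ | inj₁ _ = b

  unionSym : ∀ b G₁ G₂ u v → unionAdj b G₁ G₂ u v ≡ unionAdj b G₁ G₂ v u
  unionSym b G₁ G₂ u v with splitAt (n G₁) u | splitAt (n G₁) v
  ... | inj₁ i | inj₁ j = sym G₁ i j
  ... | inj₂ i | inj₂ j = sym G₂ i j
  ... | inj₁ _ | inj₂ _ = refl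
  ... | inj₂ _ | inj₁ _ = refl

  unionIrr : ∀ b G₁ G₂ u → unionAdj b G₁ G₂ u u ≡ false
  unionIrr b G₁ G₂ u with splitAt (n G₁) u
  ... | inj₁ i = irrefl G₁ i
  ... | inj₂ i = irrefl G₂ i

  unionWith : Bool → Graph → Graph → Graph
  unionWith b G₁ G₂ = record
    { n = n G₁ + n G₂ ; adj = unionAdj b G₁ G₂
    ; sym = unionSym b G₁ G₂ ; irrefl = unionIrr b G₁ G₂ }

_∪ᴳ_ : Graph → Graph → Graph
G₁ ∪ᴳ G₂ = unionWith false G₁ G₂

_∨ᴳ_ : Graph → Graph → Graph
G₁ ∨ᴳ G₂ = unionWith true G₁ G₂

-- Spiders and quasi-spiders.
-- A vertex is labelled by its part: R, or c i ∈ C, or s i ∈ S (i : Fin k).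

data Label (k : ℕ) : Set where
  r : Label k
  c : Fin k → Label k
  s : Fin k → Label k

-- Adjacency requirements between two distinct vertices with different labels
-- (pairs inside R, and the two copies of a replaced vertex, are unconstrained).
-- thin = true: s i ~ c j iff i = j;  thin = false (thick): iff i ≠ j.
SpiderAdj : (G : Graph) (k : ℕ) (thin : Bool) → Fin (n G) → Fin (n G) → Label k → Label k → Set
SpiderAdj G k thin  u v r     r     = ⊤
SpiderAdj G k thin  u v r     (c j) = Edge G u v
SpiderAdj G k thin  u v r     (s j) = ¬ Edge G u v
SpiderAdj G k thin  u v (c i) r     = Edge G u v
SpiderAdj G k thin  u v (s i) r     = ¬ Edge G u v
SpiderAdj G k thin  u v (c i) (c j) = i ≢ j → Edge G u v
SpiderAdj G k thin  u v (s i) (s j) = i ≢ j → ¬ Edge G u v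
SpiderAdj G k true  u v (c i) (s j) = (Edge G u v → i ≡ j) × (i ≡ j → Edge G u v)
SpiderAdj G k false u v (c i) (s j) = (Edge G u v → i ≢ j) × (i ≢ j → Edge G u v)
SpiderAdj G k true  u v (s i) (c j) = (Edge G u v → i ≡ j) × (i ≡ j → Edge G u v)
SpiderAdj G k false u v (s i) (c j) = (Edge G u v → i ≢ j) × (i ≢ j → Edge G u v)

Single : (G : Graph) {k : ℕ} → (Fin (n G) → Label k) → Label k → Set
Single G lab l = ∃[ u ] (lab u ≡ l × ∀ v → lab v ≡ l → v ≡ u)

Double : (G : Graph) {k : ℕ} → (Fin (n G) → Label k) → Label k → Set
Double G lab l = ∃[ u ] ∃[ w ] (u ≢ w × lab u ≡ l × lab w ≡ l × (∀ v → lab v ≡ l → v ≡ u ⊎ v ≡ w))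

-- multiplicity condition: the (at most one) replaced vertex `d` of C ∪ S is
-- carried by two vertices (a K₂ or a co-K₂), every other vertex of C ∪ S by one.
-- (d = nothing, or d = just r, means nothing was replaced: a spider.)
Mult : (G : Graph) {k : ℕ} → (Fin (n G) → Label k) → Maybe (Label k) → Label k → Set
Mult G lab d l = (just l ≡ d → Double G lab l) × (just l ≢ d → Single G lab l)

IsQuasiSpider : Graph → Set
IsQuasiSpider G =
  Σ ℕ λ k → 2 ≤ k × Σ Bool λ thin → Σ (Fin (n G) → Label k) λ lab → Σ (Maybe (Label k)) λ d →
    (∀ i → Mult G lab d (c i)) × (∀ i → Mult G lab d (s i)) ×
    (∀ u v → u ≢ v → lab u ≢ lab v → SpiderAdj G k thin u v (lab u) (lab v))

-- Every graph has a maximal clique, so no clique colouring uses fewer than two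
-- colours.  A 2-colouring is a clique colouring as soon as every vertex u has an
-- escape: a vertex w of the other colour adjacent to every vertex of u's colour in
-- the closed neighbourhood of u.  For a join, colour by side: any vertex of the
-- other side is an escape.  For a quasi-spider, colour {c₀} ∪ {sᵢ | i ≠ 0} (thin)
-- or {c₀ , s₀} (thick) against the rest; a suitable vertex of C is then an escape
-- for every vertex.  For a disjoint union, a clique meeting one side stays there,
-- so the maximal cliques of G₁ ∪ G₂ are those of G₁ and those of G₂: clique
-- colourings of the union restrict to the parts, and colourings of the parts
-- combine into one of the union with max{k₁ , k₂} colours.
module Submission where

open import Defs
open import Data.Nat using (ℕ; _⊔_; _>_)
open import Data.Product using (_×_)

open import Data.Bool using (Bool; true; false)
import Data.Bool.Properties as Bool
open import Data.Empty using (⊥-elim)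
open import Data.Fin using (Fin; zero; suc; splitAt; _↑ˡ_; _↑ʳ_; inject≤; fromℕ<)
open import Data.Fin.Patterns using (0F; 1F)
open import Data.Fin.Properties
  using (any?; all?; splitAt-↑ˡ; splitAt-↑ʳ; splitAt⁻¹-↑ˡ; splitAt⁻¹-↑ʳ; inject≤-injective)
  renaming (_≟_ to _≟ᶠ_)
open import Data.Fin.Subset using (Subset; _∈_; _⊆_; _⊂_; _⊃_; _∪_; ⁅_⁆; Nonempty) renaming (⊥ to ∅)
open import Data.Fin.Subset.Properties
  using (_∈?_; x∈⁅x⁆; x∈⁅y⁆⇒x≡y; x∈p∪q⁺; x∈p∪q⁻; p⊆p∪q; ∉⊥; nonempty?)
open import Data.Fin.Subset.Induction using (Acc; acc; ⊃-wellFounded)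
open import Data.Maybe using (Maybe; just; nothing; maybe′)
open import Data.Maybe.Properties using (just-injective) renaming (≡-dec to ≡-decᵐ)
open import Data.Nat using (zero; suc; _+_; _≤_; z≤n; s≤s)
open import Data.Nat.Properties using (m≤m⊔n; m≤n⊔m; ⊔-lub)
open import Data.Product using (Σ; ∃; ∃-syntax; _,_; proj₁; proj₂)
open import Data.Sum using (_⊎_; inj₁; inj₂; [_,_]′; isInj₁; isInj₂)
import Data.Sum as Sum
open import Data.Vec using (lookup; tabulate)
open import Data.Vec.Properties using ([]=⇒lookup; lookup⇒[]=; lookup∘tabulate)
open import Function using (_∘_; const)
open import Relation.Binary.Definitions using (DecidableEquality)
open import Relation.Binary.PropositionalEquality as ≡ using (_≡_; _≢_; refl; trans; cong; subst)
open import Relation.Nullary using (¬_; Dec; yes; no; map′)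
open import Relation.Nullary.Decidable using (¬?; _×-dec_; _→-dec_)

∈-tabulate⁺ : ∀ {m} {f : Fin m → Bool} {x} → f x ≡ true → x ∈ tabulate f
∈-tabulate⁺ {f = f} {x} fx = lookup⇒[]= x (tabulate f) (trans (lookup∘tabulate f x) fx)

∈-tabulate⁻ : ∀ {m} {f : Fin m → Bool} {x} → x ∈ tabulate f → f x ≡ true
∈-tabulate⁻ {f = f} {x} x∈ = trans (≡.sym (lookup∘tabulate f x)) ([]=⇒lookup x∈)

∈-∪⁅⁆⁻ : ∀ {m} (p : Subset m) {x} y → x ∈ p ∪ ⁅ y ⁆ → x ∈ p ⊎ x ≡ y
∈-∪⁅⁆⁻ p y = Sum.map₂ (x∈⁅y⁆⇒x≡y y) ∘ x∈p∪q⁻ p ⁅ y ⁆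

≢⇒2≤ : ∀ {k} {a b : Fin k} → a ≢ b → 2 ≤ k
≢⇒2≤ {suc (suc _)} _                 = s≤s (s≤s z≤n)
≢⇒2≤ {suc zero}    {zero} {zero} a≢b = ⊥-elim (a≢b refl)

↑-view : ∀ m {m′} (v : Fin (m + m′)) → (∃ λ i → i ↑ˡ m′ ≡ v) ⊎ (∃ λ j → m ↑ʳ j ≡ v)
↑-view m v with splitAt m v in eq
... | inj₁ i = inj₁ (i , splitAt⁻¹-↑ˡ eq)
... | inj₂ j = inj₂ (j , splitAt⁻¹-↑ʳ eq)

adj≡false⇒¬Edge : (G : Graph) {u v : Fin (n G)} → adj G u v ≡ false → ¬ Edge G u v
adj≡false⇒¬Edge G uv≡false uv with () ← trans (≡.sym uv≡false) uv

Edge⇒≢ : (G : Graph) {u v : Fin (n G)} → Edge G u v → u ≢ v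
Edge⇒≢ G {u} uv refl = adj≡false⇒¬Edge G (irrefl G u) uv

Edge-sym : (G : Graph) {u v : Fin (n G)} → Edge G u v → Edge G v u
Edge-sym G {u} {v} uv = trans (Graph.sym G v u) uv

Edge? : (G : Graph) (u v : Fin (n G)) → Dec (Edge G u v)
Edge? G u v = adj G u v Bool.≟ true

AdjacentToAll : (G : Graph) → Subset (n G) → Fin (n G) → Set
AdjacentToAll G Q w = ∀ x → x ∈ Q → x ≢ w → Edge G x w

IsClique-∪⁅⁆ : (G : Graph) {Q : Subset (n G)} {w : Fin (n G)} →
               IsClique G Q → AdjacentToAll G Q w → IsClique G (Q ∪ ⁅ w ⁆)
IsClique-∪⁅⁆ G {Q} {w} clique toW u v u∈ v∈ u≢v with ∈-∪⁅⁆⁻ Q w u∈ | ∈-∪⁅⁆⁻ Q w v∈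
... | inj₁ u∈Q | inj₁ v∈Q = clique u v u∈Q v∈Q u≢v
... | inj₁ u∈Q | inj₂ refl = toW u u∈Q u≢v
... | inj₂ refl | inj₁ v∈Q = Edge-sym G (toW v v∈Q (u≢v ∘ ≡.sym))
... | inj₂ refl | inj₂ refl = ⊥-elim (u≢v refl)

IsMaximalClique-closed : (G : Graph) {Q : Subset (n G)} {w : Fin (n G)} →
                         IsMaximalClique G Q → AdjacentToAll G Q w → w ∈ Q
IsMaximalClique-closed G {Q} {w} (clique , maximal) toW =
  maximal (Q ∪ ⁅ w ⁆) (IsClique-∪⁅⁆ G clique toW) (p⊆p∪q ⁅ w ⁆) (x∈p∪q⁺ (inj₂ (x∈⁅x⁆ w)))

extendToMaximalClique : (G : Graph) (Q : Subset (n G)) → Acc _⊃_ Q → IsClique G Q →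
                        Σ (Subset (n G)) (IsMaximalClique G)
extendToMaximalClique G Q (acc larger) clique
  with any? (λ w → ¬? (w ∈? Q) ×-dec all? (λ x → (x ∈? Q) →-dec (¬? (x ≟ᶠ w) →-dec Edge? G x w)))
... | yes (w , w∉Q , toW) =
  extendToMaximalClique G (Q ∪ ⁅ w ⁆) (larger Q⊂Q∪w) (IsClique-∪⁅⁆ G clique toW)
  where
  Q⊂Q∪w : Q ⊂ Q ∪ ⁅ w ⁆
  Q⊂Q∪w = p⊆p∪q ⁅ w ⁆ , w , x∈p∪q⁺ (inj₂ (x∈⁅x⁆ w)) , w∉Q
... | no noExtension = Q , clique , maximal
  where
  maximal : ∀ Q′ → IsClique G Q′ → Q ⊆ Q′ → Q′ ⊆ Q
  maximal Q′ clique′ Q⊆Q′ {v} v∈Q′ with v ∈? Q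
  ... | yes v∈Q = v∈Q
  ... | no v∉Q = ⊥-elim (noExtension (v , v∉Q , λ x x∈Q x≢v → clique′ x v (Q⊆Q′ x∈Q) v∈Q′ x≢v))

maximalClique : (G : Graph) → Σ (Subset (n G)) (IsMaximalClique G)
maximalClique G = extendToMaximalClique G ∅ (⊃-wellFounded ∅) (λ u _ u∈∅ → ⊥-elim (∉⊥ u∈∅))

IsMaximalClique-nonempty : (G : Graph) {Q : Subset (n G)} → Fin (n G) → IsMaximalClique G Q → Nonempty Q
IsMaximalClique-nonempty G {Q} v maximalQ with nonempty? Q
... | yes nonempty = nonempty
... | no empty = v , IsMaximalClique-closed G maximalQ (λ x x∈Q → ⊥-elim (empty (x , x∈Q)))

HasCliqueColoring⇒vertex : (G : Graph) {k : ℕ} → HasCliqueColoring G k → Fin (n G)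
HasCliqueColoring⇒vertex G (_ , isColoring) =
  let Q , maximalQ = maximalClique G in proj₁ (isColoring Q maximalQ)

HasCliqueColoring⇒2≤ : (G : Graph) {k : ℕ} → HasCliqueColoring G k → 2 ≤ k
HasCliqueColoring⇒2≤ G (_ , isColoring) =
  let Q , maximalQ = maximalClique G
      _ , _ , _ , _ , a≢b = isColoring Q maximalQ
  in ≢⇒2≤ a≢b

IsCliqueColoring-refine : (G : Graph) {k k′ : ℕ} {col : Fin (n G) → Fin k} {col′ : Fin (n G) → Fin k′} →
                          (∀ u v → col u ≢ col v → col′ u ≢ col′ v) →
                          IsCliqueColoring G k col → IsCliqueColoring G k′ col′
IsCliqueColoring-refine G separates isColoring Q maximalQ =
  let u , v , u∈Q , v∈Q , u≢v = isColoring Q maximalQ in u , v , u∈Q , v∈Q , separates u v u≢v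

ClosedNeighbour : (G : Graph) → Fin (n G) → Fin (n G) → Set
ClosedNeighbour G u x = x ≡ u ⊎ Edge G x u

Escape : (G : Graph) {k : ℕ} → (Fin (n G) → Fin k) → Fin (n G) → Set
Escape G col u = ∃ λ w → col w ≢ col u × (∀ x → ClosedNeighbour G u x → col x ≡ col u → Edge G x w)

-- A monochromatic maximal clique through u would be extended by the escape of u.
escapes⇒IsCliqueColoring : (G : Graph) {k : ℕ} (col : Fin (n G) → Fin k) → Fin (n G) →
                           (∀ u → Escape G col u) → IsCliqueColoring G k col
escapes⇒IsCliqueColoring G col v escape Q maximalQ@(clique , _)
  with u , u∈Q ← IsMaximalClique-nonempty G v maximalQ
  with any? (λ x → (x ∈? Q) ×-dec ¬? (col x ≟ᶠ col u))
... | yes (x , x∈Q , x≢u) = x , u , x∈Q , u∈Q , x≢u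
... | no monochromatic with w , w≢u , toW ← escape u =
  ⊥-elim (w≢u (colourOfMember (IsMaximalClique-closed G maximalQ adjacentToW)))
  where
  colourOfMember : ∀ {x} → x ∈ Q → col x ≡ col u
  colourOfMember {x} x∈Q with col x ≟ᶠ col u
  ... | yes same = same
  ... | no differ = ⊥-elim (monochromatic (x , x∈Q , differ))

  adjacentToW : AdjacentToAll G Q w
  adjacentToW x x∈Q _ with x ≟ᶠ u
  ... | yes x≡u = toW x (inj₁ x≡u) (colourOfMember x∈Q)
  ... | no x≢u = toW x (inj₂ (clique x u x∈Q u∈Q x≢u)) (colourOfMember x∈Q)

escapes⇒ChiC≡2 : (G : Graph) (col : Fin (n G) → Fin 2) → Fin (n G) →
                 (∀ u → Escape G col u) → ChiC≡ G 2
escapes⇒ChiC≡2 G col v escape =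
  (col , escapes⇒IsCliqueColoring G col v escape) , λ _ → HasCliqueColoring⇒2≤ G

escape-across : (G : Graph) {k : ℕ} (col : Fin (n G) → Fin k) →
                (∀ x y → col x ≢ col y → Edge G x y) →
                ∀ {u} w → col w ≢ col u → Escape G col u
escape-across G col across w w≢u = w , w≢u , λ x _ x≡u → across x w (λ x≡w → w≢u (trans (≡.sym x≡w) x≡u))

other-colour : {A : Set} {k : ℕ} (col : A → Fin k) {a b : A} → col a ≢ col b →
               ∀ u → ∃ λ w → col w ≢ col u
other-colour col {a} {b} a≢b u with col u ≟ᶠ col a
... | yes u≡a = b , λ b≡u → a≢b (trans (≡.sym u≡a) (≡.sym b≡u))
... | no u≢a = a , u≢a ∘ ≡.sym

-- Joins

side : ∀ m {m′} → Fin (m + m′) → Fin 2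
side m = [ const 0F , const 1F ]′ ∘ splitAt m

∨ᴳ-edge-across : (G₁ G₂ : Graph) (x y : Fin (n G₁ + n G₂)) →
                 side (n G₁) x ≢ side (n G₁) y → Edge (G₁ ∨ᴳ G₂) x y
∨ᴳ-edge-across G₁ G₂ x y x≢y with splitAt (n G₁) x | splitAt (n G₁) y
... | inj₁ _ | inj₁ _ = ⊥-elim (x≢y refl)
... | inj₁ _ | inj₂ _ = refl
... | inj₂ _ | inj₁ _ = refl
... | inj₂ _ | inj₂ _ = ⊥-elim (x≢y refl)

ChiC-∨ᴳ : (G₁ G₂ : Graph) → n G₁ > 0 → n G₂ > 0 → ChiC≡ (G₁ ∨ᴳ G₂) 2
ChiC-∨ᴳ G₁ G₂ n₁>0 n₂>0 = escapes⇒ChiC≡2 (G₁ ∨ᴳ G₂) (side (n G₁)) left escape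
  where
  left right : Fin (n G₁ + n G₂)
  left = fromℕ< n₁>0 ↑ˡ n G₂
  right = n G₁ ↑ʳ fromℕ< n₂>0

  left≢right : side (n G₁) left ≢ side (n G₁) right
  left≢right rewrite splitAt-↑ˡ (n G₁) (fromℕ< n₁>0) (n G₂) | splitAt-↑ʳ (n G₁) (n G₂) (fromℕ< n₂>0) = λ ()

  escape : ∀ u → Escape (G₁ ∨ᴳ G₂) (side (n G₁)) u
  escape u =
    let w , w≢u = other-colour (side (n G₁)) left≢right u
    in escape-across (G₁ ∨ᴳ G₂) (side (n G₁)) (∨ᴳ-edge-across G₁ G₂) w w≢u

-- Components and disjoint unions

-- G sits in H as a union of connected components: `from` inverts `to` on its
-- image, and no edge of H leaves the image.
module ComponentEmbedding
  (H G : Graph) (to : Fin (n G) → Fin (n H)) (from : Fin (n H) → Maybe (Fin (n G)))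
  (from-to : ∀ i → from (to i) ≡ just i)
  (to-from : ∀ {v i} → from v ≡ just i → to i ≡ v)
  (adj-to : ∀ i j → adj H (to i) (to j) ≡ adj G i j)
  (outside : ∀ {v} i → from v ≡ nothing → ¬ Edge H (to i) v)
  where

  to-injective : ∀ {i j} → to i ≡ to j → i ≡ j
  to-injective {i} {j} eq = just-injective (trans (≡.sym (from-to i)) (trans (cong from eq) (from-to j)))

  pull : Subset (n H) → Subset (n G)
  pull Q = tabulate (lookup Q ∘ to)

  push : Subset (n G) → Subset (n H)
  push P = tabulate (maybe′ (lookup P) false ∘ from)

  ∈-pull⁺ : ∀ {Q i} → to i ∈ Q → i ∈ pull Q
  ∈-pull⁺ i∈Q = ∈-tabulate⁺ ([]=⇒lookup i∈Q)

  ∈-pull⁻ : ∀ {Q i} → i ∈ pull Q → to i ∈ Q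
  ∈-pull⁻ {Q} i∈ = lookup⇒[]= _ Q (∈-tabulate⁻ i∈)

  ∈-push⁺ : ∀ {P i} → i ∈ P → to i ∈ push P
  ∈-push⁺ {P} {i} i∈P = ∈-tabulate⁺ (trans (cong (maybe′ (lookup P) false) (from-to i)) ([]=⇒lookup i∈P))

  ∈-push⁻ : ∀ {P v} → v ∈ push P → ∃ λ i → to i ≡ v × i ∈ P
  ∈-push⁻ {P} {v} v∈ with from v in eq | ∈-tabulate⁻ v∈
  ... | just i | i∈P = i , to-from eq , lookup⇒[]= i P i∈P

  clique-stays-in-image : ∀ {Q i v} → IsClique H Q → to i ∈ Q → v ∈ Q → ∃ λ j → to j ≡ v
  clique-stays-in-image {i = i} {v} clique i∈Q v∈Q with from v in eq
  ... | just j = j , to-from eq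
  ... | nothing = ⊥-elim (outside i eq (clique (to i) v i∈Q v∈Q to-i≢v))
    where
    to-i≢v : to i ≢ v
    to-i≢v refl with () ← trans (≡.sym (from-to i)) eq

  pull-IsClique : ∀ {Q} → IsClique H Q → IsClique G (pull Q)
  pull-IsClique clique i j i∈ j∈ i≢j =
    trans (≡.sym (adj-to i j)) (clique _ _ (∈-pull⁻ i∈) (∈-pull⁻ j∈) (i≢j ∘ to-injective))

  push-IsClique : ∀ {P} → IsClique G P → IsClique H (push P)
  push-IsClique clique u v u∈ v∈ u≢v
    with i , refl , i∈P ← ∈-push⁻ u∈ | j , refl , j∈P ← ∈-push⁻ v∈ =
    trans (adj-to i j) (clique i j i∈P j∈P (u≢v ∘ cong to))

  pull-IsMaximalClique : ∀ {Q i} → to i ∈ Q → IsMaximalClique H Q → IsMaximalClique G (pull Q)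
  pull-IsMaximalClique {Q} i∈Q (clique , maximal) = pull-IsClique clique , maximal′
    where
    maximal′ : ∀ P → IsClique G P → pull Q ⊆ P → P ⊆ pull Q
    maximal′ P cliqueP pullQ⊆P j∈P = ∈-pull⁺ (maximal (push P) (push-IsClique cliqueP) Q⊆pushP (∈-push⁺ j∈P))
      where
      Q⊆pushP : Q ⊆ push P
      Q⊆pushP v∈Q with j , refl ← clique-stays-in-image clique i∈Q v∈Q = ∈-push⁺ (pullQ⊆P (∈-pull⁺ v∈Q))

  push-IsMaximalClique : ∀ {P i} → i ∈ P → IsMaximalClique G P → IsMaximalClique H (push P)
  push-IsMaximalClique {P} i∈P (clique , maximal) = push-IsClique clique , maximal′
    where
    maximal′ : ∀ Q → IsClique H Q → push P ⊆ Q → Q ⊆ push P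
    maximal′ Q cliqueQ pushP⊆Q v∈Q
      with j , refl ← clique-stays-in-image cliqueQ (pushP⊆Q (∈-push⁺ i∈P)) v∈Q =
      ∈-push⁺ (maximal (pull Q) (pull-IsClique cliqueQ) (∈-pull⁺ ∘ pushP⊆Q ∘ ∈-push⁺) (∈-pull⁺ v∈Q))

  restrict-IsCliqueColoring : ∀ {k} {col : Fin (n H) → Fin k} → Fin (n G) →
                              IsCliqueColoring H k col → IsCliqueColoring G k (col ∘ to)
  restrict-IsCliqueColoring v isColoring P maximalP
    with i , i∈P ← IsMaximalClique-nonempty G v maximalP
    with a , b , a∈ , b∈ , a≢b ← isColoring (push P) (push-IsMaximalClique i∈P maximalP)
    with i , refl , i∈P ← ∈-push⁻ a∈ | j , refl , j∈P ← ∈-push⁻ b∈ = i , j , i∈P , j∈P , a≢b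

  meets-image⇒bicoloured : ∀ {k} {col : Fin (n H) → Fin k} → IsCliqueColoring G k (col ∘ to) →
                           ∀ {Q i} → IsMaximalClique H Q → to i ∈ Q →
                           ∃[ u ] ∃[ v ] (u ∈ Q × v ∈ Q × col u ≢ col v)
  meets-image⇒bicoloured isColoring maximalQ i∈Q
    with a , b , a∈ , b∈ , a≢b ← isColoring _ (pull-IsMaximalClique i∈Q maximalQ) =
    to a , to b , ∈-pull⁻ a∈ , ∈-pull⁻ b∈ , a≢b

module ∪ᴳ-Components (G₁ G₂ : Graph) where

  private
    n₁ = n G₁
    n₂ = n G₂

  ∪ᴳ-adj-↑ˡ : ∀ i j → adj (G₁ ∪ᴳ G₂) (i ↑ˡ n₂) (j ↑ˡ n₂) ≡ adj G₁ i j
  ∪ᴳ-adj-↑ˡ i j rewrite splitAt-↑ˡ n₁ i n₂ | splitAt-↑ˡ n₁ j n₂ = refl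

  ∪ᴳ-adj-↑ʳ : ∀ i j → adj (G₁ ∪ᴳ G₂) (n₁ ↑ʳ i) (n₁ ↑ʳ j) ≡ adj G₂ i j
  ∪ᴳ-adj-↑ʳ i j rewrite splitAt-↑ʳ n₁ n₂ i | splitAt-↑ʳ n₁ n₂ j = refl

  ∪ᴳ-adj-↑ˡ↑ʳ : ∀ i j → adj (G₁ ∪ᴳ G₂) (i ↑ˡ n₂) (n₁ ↑ʳ j) ≡ false
  ∪ᴳ-adj-↑ˡ↑ʳ i j rewrite splitAt-↑ˡ n₁ i n₂ | splitAt-↑ʳ n₁ n₂ j = refl

  ∪ᴳ-adj-↑ʳ↑ˡ : ∀ i j → adj (G₁ ∪ᴳ G₂) (n₁ ↑ʳ i) (j ↑ˡ n₂) ≡ false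
  ∪ᴳ-adj-↑ʳ↑ˡ i j rewrite splitAt-↑ʳ n₁ n₂ i | splitAt-↑ˡ n₁ j n₂ = refl

  from₁ : Fin (n₁ + n₂) → Maybe (Fin n₁)
  from₁ = isInj₁ ∘ splitAt n₁

  from₂ : Fin (n₁ + n₂) → Maybe (Fin n₂)
  from₂ = isInj₂ ∘ splitAt n₁

  to-from₁ : ∀ {v i} → from₁ v ≡ just i → i ↑ˡ n₂ ≡ v
  to-from₁ {v} eq with splitAt n₁ v in split
  to-from₁ refl | inj₁ _ = splitAt⁻¹-↑ˡ split

  to-from₂ : ∀ {v i} → from₂ v ≡ just i → n₁ ↑ʳ i ≡ v
  to-from₂ {v} eq with splitAt n₁ v in split
  to-from₂ refl | inj₂ _ = splitAt⁻¹-↑ʳ split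

  outside₁ : ∀ {v} i → from₁ v ≡ nothing → ¬ Edge (G₁ ∪ᴳ G₂) (i ↑ˡ n₂) v
  outside₁ {v} i eq with ↑-view n₁ v
  outside₁ i eq | inj₂ (j , refl) = adj≡false⇒¬Edge (G₁ ∪ᴳ G₂) (∪ᴳ-adj-↑ˡ↑ʳ i j)
  outside₁ i eq | inj₁ (j , refl) with () ← trans (≡.sym eq) (cong isInj₁ (splitAt-↑ˡ n₁ j n₂))

  outside₂ : ∀ {v} i → from₂ v ≡ nothing → ¬ Edge (G₁ ∪ᴳ G₂) (n₁ ↑ʳ i) v
  outside₂ {v} i eq with ↑-view n₁ v
  outside₂ i eq | inj₁ (j , refl) = adj≡false⇒¬Edge (G₁ ∪ᴳ G₂) (∪ᴳ-adj-↑ʳ↑ˡ i j)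
  outside₂ i eq | inj₂ (j , refl) with () ← trans (≡.sym eq) (cong isInj₂ (splitAt-↑ʳ n₁ n₂ j))

  module Left = ComponentEmbedding (G₁ ∪ᴳ G₂) G₁ (_↑ˡ n₂) from₁
    (λ i → cong isInj₁ (splitAt-↑ˡ n₁ i n₂)) to-from₁ ∪ᴳ-adj-↑ˡ outside₁

  module Right = ComponentEmbedding (G₁ ∪ᴳ G₂) G₂ (n₁ ↑ʳ_) from₂
    (λ i → cong isInj₂ (splitAt-↑ʳ n₁ n₂ i)) to-from₂ ∪ᴳ-adj-↑ʳ outside₂

ChiC-∪ᴳ : (G₁ G₂ : Graph) (k₁ k₂ : ℕ) → ChiC≡ G₁ k₁ → ChiC≡ G₂ k₂ → ChiC≡ (G₁ ∪ᴳ G₂) (k₁ ⊔ k₂)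
ChiC-∪ᴳ G₁ G₂ k₁ k₂ (χ₁@(col₁ , isColoring₁) , minimal₁) (χ₂@(col₂ , isColoring₂) , minimal₂) =
  (col , isColoring) , minimal
  where
  open ∪ᴳ-Components G₁ G₂

  v₁ = HasCliqueColoring⇒vertex G₁ χ₁
  v₂ = HasCliqueColoring⇒vertex G₂ χ₂

  col₁′ : Fin (n G₁) → Fin (k₁ ⊔ k₂)
  col₁′ i = inject≤ (col₁ i) (m≤m⊔n k₁ k₂)

  col₂′ : Fin (n G₂) → Fin (k₁ ⊔ k₂)
  col₂′ j = inject≤ (col₂ j) (m≤n⊔m k₁ k₂)

  col : Fin (n G₁ + n G₂) → Fin (k₁ ⊔ k₂)
  col = [ col₁′ , col₂′ ]′ ∘ splitAt (n G₁)

  col-↑ˡ : ∀ i → col (i ↑ˡ n G₂) ≡ col₁′ i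
  col-↑ˡ i = cong [ col₁′ , col₂′ ]′ (splitAt-↑ˡ (n G₁) i (n G₂))

  col-↑ʳ : ∀ j → col (n G₁ ↑ʳ j) ≡ col₂′ j
  col-↑ʳ j = cong [ col₁′ , col₂′ ]′ (splitAt-↑ʳ (n G₁) (n G₂) j)

  isColoring-↑ˡ : IsCliqueColoring G₁ (k₁ ⊔ k₂) (col ∘ (_↑ˡ n G₂))
  isColoring-↑ˡ = IsCliqueColoring-refine G₁
    (λ i j i≢j eq → i≢j (inject≤-injective _ _ _ _ (trans (≡.sym (col-↑ˡ i)) (trans eq (col-↑ˡ j)))))
    isColoring₁

  isColoring-↑ʳ : IsCliqueColoring G₂ (k₁ ⊔ k₂) (col ∘ (n G₁ ↑ʳ_))
  isColoring-↑ʳ = IsCliqueColoring-refine G₂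
    (λ i j i≢j eq → i≢j (inject≤-injective _ _ _ _ (trans (≡.sym (col-↑ʳ i)) (trans eq (col-↑ʳ j)))))
    isColoring₂

  isColoring : IsCliqueColoring (G₁ ∪ᴳ G₂) (k₁ ⊔ k₂) col
  isColoring Q maximalQ
    with u , u∈Q ← IsMaximalClique-nonempty (G₁ ∪ᴳ G₂) (v₁ ↑ˡ n G₂) maximalQ
    with ↑-view (n G₁) u
  ... | inj₁ (_ , refl) = Left.meets-image⇒bicoloured isColoring-↑ˡ maximalQ u∈Q
  ... | inj₂ (_ , refl) = Right.meets-image⇒bicoloured isColoring-↑ʳ maximalQ u∈Q

  minimal : ∀ j → HasCliqueColoring (G₁ ∪ᴳ G₂) j → k₁ ⊔ k₂ ≤ j
  minimal j (col′ , isColoring′) =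
    ⊔-lub (minimal₁ j (_ , Left.restrict-IsCliqueColoring v₁ isColoring′))
          (minimal₂ j (_ , Right.restrict-IsCliqueColoring v₂ isColoring′))

-- Quasi-spiders

_≟ˡ_ : ∀ {k} → DecidableEquality (Label k)
r   ≟ˡ r   = yes refl
c i ≟ˡ c j = map′ (cong c) (λ { refl → refl }) (i ≟ᶠ j)
s i ≟ˡ s j = map′ (cong s) (λ { refl → refl }) (i ≟ᶠ j)
r   ≟ˡ c _ = no λ ()
r   ≟ˡ s _ = no λ ()
c _ ≟ˡ r   = no λ ()
c _ ≟ˡ s _ = no λ ()
s _ ≟ˡ r   = no λ ()
s _ ≟ˡ c _ = no λ ()

Mult⇒carrier : (G : Graph) {k : ℕ} {lab : Fin (n G) → Label k} {d : Maybe (Label k)} {l : Label k} →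
               Mult G lab d l → ∃ λ v → lab v ≡ l
Mult⇒carrier G {d = d} {l} (double , single) with ≡-decᵐ _≟ˡ_ (just l) d
... | yes replaced = let u , _ , _ , lab-u , _ = double replaced in u , lab-u
... | no kept = let u , lab-u , _ = single kept in u , lab-u

Attached : ∀ {k} → Bool → Fin k → Fin k → Set
Attached true  i j = i ≡ j
Attached false i j = i ≢ j

SpiderAdj-s-c : ∀ {G k} thin {u v i j} → SpiderAdj G k thin u v (s i) (c j) →
                (Edge G u v → Attached thin i j) × (Attached thin i j → Edge G u v)
SpiderAdj-s-c true  spiderAdj = spiderAdj
SpiderAdj-s-c false spiderAdj = spiderAdj

colour : ∀ {k} → Bool → Label (2 + k) → Fin 2
colour true  r           = 0F
colour true  (c 0F)      = 1F
colour true  (c (suc _)) = 0F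
colour true  (s 0F)      = 0F
colour true  (s (suc _)) = 1F
colour false r           = 0F
colour false (c 0F)      = 1F
colour false (c (suc _)) = 0F
colour false (s 0F)      = 1F
colour false (s (suc _)) = 0F

-- The escape of a vertex labelled l will be a vertex labelled c (target thin l).
target : ∀ {k} → Bool → Label (2 + k) → Fin (2 + k)
target true  r           = 0F
target true  (c 0F)      = 1F
target true  (c (suc _)) = 0F
target true  (s i)       = i
target false r           = 0F
target false (c 0F)      = 1F
target false (c (suc _)) = 0F
target false (s 0F)      = 1F
target false (s (suc _)) = 0F

colour-target : ∀ {k} thin (l : Label (2 + k)) → colour thin (c (target thin l)) ≢ colour thin l
colour-target true  r           ()
colour-target true  (c 0F)      ()
colour-target true  (c (suc _)) ()
colour-target true  (s 0F)      ()
colour-target true  (s (suc _)) ()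
colour-target false r           ()
colour-target false (c 0F)      ()
colour-target false (c (suc _)) ()
colour-target false (s 0F)      ()
colour-target false (s (suc _)) ()

target-attached : ∀ {k} thin (i : Fin (2 + k)) (l : Label (2 + k)) →
                  colour thin (s i) ≡ colour thin l →
                  (s i ≡ l ⊎ ∃ λ j → l ≡ c j × Attached thin i j) →
                  Attached thin i (target thin l)
target-attached true  _       r           _  (inj₁ ())
target-attached true  _       r           _  (inj₂ (_ , () , _))
target-attached true  _       (s _)       _  (inj₁ refl)             = refl
target-attached true  _       (s _)       _  (inj₂ (_ , () , _))
target-attached true  _       (c _)       _  (inj₁ ())
target-attached true  0F      (c 0F)      () (inj₂ (_ , refl , refl))
target-attached true  0F      (c (suc _)) _  (inj₂ (_ , refl , ()))
target-attached true  (suc _) (c 0F)      _  (inj₂ (_ , refl , ()))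
target-attached true  (suc _) (c (suc _)) () (inj₂ (_ , refl , refl))
target-attached false 0F      r           ()
target-attached false (suc _) r           _  _ = λ ()
target-attached false 0F      (c 0F)      _  _ = λ ()
target-attached false (suc _) (c 0F)      ()
target-attached false 0F      (c (suc _)) ()
target-attached false (suc _) (c (suc _)) _  _ = λ ()
target-attached false 0F      (s 0F)      _  _ = λ ()
target-attached false (suc _) (s 0F)      ()
target-attached false 0F      (s (suc _)) ()
target-attached false (suc _) (s (suc _)) _  _ = λ ()

module QuasiSpider
  (G : Graph) {k : ℕ} (thin : Bool) (lab : Fin (n G) → Label (2 + k))
  (spiderAdj : ∀ u v → u ≢ v → lab u ≢ lab v → SpiderAdj G (2 + k) thin u v (lab u) (lab v))
  where

  col : Fin (n G) → Fin 2
  col = colour thin ∘ lab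

  s-neighbour-label : ∀ {x u i} lu → s i ≢ lu → SpiderAdj G (2 + k) thin x u (s i) lu →
                      Edge G x u → ∃ λ j → lu ≡ c j × Attached thin i j
  s-neighbour-label r     _     nonadjacent xu = ⊥-elim (nonadjacent xu)
  s-neighbour-label (c j) _     adjacency   xu = j , refl , proj₁ (SpiderAdj-s-c thin adjacency) xu
  s-neighbour-label (s m) si≢sm nonadjacent xu = ⊥-elim (nonadjacent (si≢sm ∘ cong s) xu)

  closedNeighbour-s : ∀ {u x i} → ClosedNeighbour G u x → lab x ≡ s i →
                      s i ≡ lab u ⊎ ∃ λ j → lab u ≡ c j × Attached thin i j
  closedNeighbour-s (inj₁ refl) lab-x = inj₁ (≡.sym lab-x)
  closedNeighbour-s {u} {x} (inj₂ xu) lab-x with lab x ≟ˡ lab u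
  ... | yes same = inj₁ (trans (≡.sym lab-x) same)
  ... | no differ = inj₂ (s-neighbour-label (lab u) (λ eq → differ (trans lab-x eq))
                           (subst (λ l → SpiderAdj G (2 + k) thin x u l (lab u)) lab-x
                                  (spiderAdj x u (Edge⇒≢ G xu) differ))
                           xu)

  edge-to-c-label : ∀ {x w j} lx → lx ≢ c j → (∀ {i} → lx ≡ s i → Attached thin i j) →
                    SpiderAdj G (2 + k) thin x w lx (c j) → Edge G x w
  edge-to-c-label r     _     _        adjacency = adjacency
  edge-to-c-label (c _) ci≢cj _        adjacency = adjacency (λ { refl → ci≢cj refl })
  edge-to-c-label (s _) _     attached adjacency = proj₂ (SpiderAdj-s-c thin adjacency) (attached refl)

  edge-to-c : ∀ {x w j} → lab w ≡ c j → lab x ≢ c j → (∀ {i} → lab x ≡ s i → Attached thin i j) →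
              Edge G x w
  edge-to-c {x} {w} lab-w lab-x≢ attached =
    edge-to-c-label (lab x) lab-x≢ attached
      (subst (SpiderAdj G (2 + k) thin x w (lab x)) lab-w
             (spiderAdj x w x≢w (λ eq → lab-x≢ (trans eq lab-w))))
    where
    x≢w : x ≢ w
    x≢w refl = lab-x≢ lab-w

  escape : (∀ j → ∃ λ w → lab w ≡ c j) → ∀ u → Escape G col u
  escape carrier u = w , w≢u , toW
    where
    j = target thin (lab u)
    w = proj₁ (carrier j)
    lab-w = proj₂ (carrier j)

    w≢u : col w ≢ col u
    w≢u eq = colour-target thin (lab u) (trans (cong (colour thin) (≡.sym lab-w)) eq)

    toW : ∀ x → ClosedNeighbour G u x → col x ≡ col u → Edge G x w
    toW x xu same = edge-to-c lab-w
      (λ lab-x → w≢u (trans (cong (colour thin) (trans lab-w (≡.sym lab-x))) same))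
      (λ lab-x → target-attached thin _ (lab u) (trans (cong (colour thin) (≡.sym lab-x)) same)
                                  (closedNeighbour-s xu lab-x))

ChiC-quasiSpider : (G : Graph) → IsQuasiSpider G → ChiC≡ G 2
ChiC-quasiSpider G (suc zero , s≤s () , _)
ChiC-quasiSpider G (suc (suc k) , _ , thin , lab , _ , multC , _ , spiderAdj) =
  escapes⇒ChiC≡2 G col (proj₁ (carrier 0F)) (escape carrier)
  where
  open QuasiSpider G thin lab spiderAdj
  carrier : ∀ j → ∃ λ w → lab w ≡ c j
  carrier j = Mult⇒carrier G (multC j)

lemma3p6 : (∀ (G₁ G₂ : Graph) (k₁ k₂ : ℕ) → ChiC≡ G₁ k₁ → ChiC≡ G₂ k₂ → ChiC≡ (G₁ ∪ᴳ G₂) (k₁ ⊔ k₂))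
    × (∀ (G₁ G₂ : Graph) → n G₁ > 0 → n G₂ > 0 → ChiC≡ (G₁ ∨ᴳ G₂) 2)
    × (∀ (G : Graph) → IsQuasiSpider G → ChiC≡ G 2)
lemma3p6 = ChiC-∪ᴳ , ChiC-∨ᴳ , ChiC-quasiSpider
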